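{- Let $G=(V,E)$ be a graph containing exactly $k$ triangles, and let $m$ denote the number of vertices of $G$ that do not lie on any triangle. Then the $\Delta$-rank satisfies $d_\Delta(G)\leq m+2k$.
   Context: All graphs are finite, simple, undirected and connected. A triangle is a set of three pairwise adjacent vertices (a copy of $K_3$). For $S\subseteq V$, the $\Delta$-interval $[S]$ is the set consisting of all vertices of $S$ together with every vertex $v\in V$ that is adjacent to both $x$ and $y$ for some pair of adjacent vertices $x,y\in S$. A set $S$ is $\Delta$-convex if $[S]=S$. The $\Delta$-convex hull $\langle S\rangle$ is the smallest $\Delta$-convex set containing $S$ (note $\langle\emptyset\rangle=\emptyset$). A set $S\subseteq V$ is convexly independent if $a\notin\langle S\setminus\{a\}\rangle$ for every $a\in S$, and convexly dependent otherwise. The rank $d_\Delta(G)$ is the least integer $n\ge0$ such that every $S\subseteq V$ with $|S|>n$ is convexly dependent (equivalently, the maximum size of a convexly independent set). -}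

module Defs where

open import Data.Nat using (ℕ; zero; suc; _+_; _<ᵇ_)
open import Data.Bool using (Bool; true; false; _∧_; not; T; if_then_else_)
open import Data.Fin using (Fin; toℕ)
open import Data.Fin.Subset using (Subset; _∈_; _⊆_; _-_)
open import Data.List using (List; allFin; map)
open import Data.Nat.ListAction using (sum)
open import Data.Product using (Σ; ∃; _×_)
open import Data.Sum using (_⊎_)
open import Data.Empty using (⊥)
open import Relation.Nullary using (¬_)
open import Relation.Binary.PropositionalEquality using (_≡_)

record Graph (n : ℕ) : Set where
  field
    adj   : Fin n → Fin n → Bool
    sym   : ∀ u v → adj u v ≡ adj v u
    irrefl : ∀ v → adj v v ≡ false

open Graph public

data Walk {n : ℕ} (G : Graph n) : Fin n → Fin n → Set where
  here : ∀ {v} → Walk G v v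
  step : ∀ {u w v} → T (adj G u w) → Walk G w v → Walk G u v

Connected : {n : ℕ} → Graph n → Set
Connected G = ∀ u v → Walk G u v

isTriangle : {n : ℕ} → Graph n → Fin n → Fin n → Fin n → Bool
isTriangle G i j l =
  (toℕ i <ᵇ toℕ j) ∧ (toℕ j <ᵇ toℕ l) ∧ adj G i j ∧ adj G j l ∧ adj G i l

indicator : Bool → ℕ
indicator b = if b then 1 else 0

triangleCount : {n : ℕ} → Graph n → ℕ
triangleCount {n} G =
  sum (map (λ i → sum (map (λ j → sum (map (λ l →
    indicator (isTriangle G i j l)) (allFin n))) (allFin n))) (allFin n))

anyFin : {n : ℕ} → (Fin n → Bool) → Bool
anyFin {zero} f = false
anyFin {suc n} f = f Fin.zero Data.Bool.∨ anyFin (λ i → f (Fin.suc i))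
  where import Data.Fin as Fin

onTriangle : {n : ℕ} → Graph n → Fin n → Bool
onTriangle G v = anyFin (λ u → anyFin (λ w → adj G v u ∧ adj G v w ∧ adj G u w))

triangleFreeVertexCount : {n : ℕ} → Graph n → ℕ
triangleFreeVertexCount {n} G =
  sum (map (λ v → indicator (not (onTriangle G v))) (allFin n))

InInterval : {n : ℕ} → Graph n → Subset n → Fin n → Set
InInterval G S v =
  v ∈ S ⊎ (Σ _ λ x → Σ _ λ y → x ∈ S × y ∈ S × T (adj G x y) × T (adj G v x) × T (adj G v y))

-- S is Δ-convex iff [S] = S (the inclusion S ⊆ [S] always holds).
DeltaConvex : {n : ℕ} → Graph n → Subset n → Set
DeltaConvex G S = ∀ v → InInterval G S v → v ∈ S

InHull : {n : ℕ} → Graph n → Subset n → Fin n → Set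
InHull {n} G S v = (C : Subset n) → S ⊆ C → DeltaConvex G C → v ∈ C

ConvexlyIndependent : {n : ℕ} → Graph n → Subset n → Set
ConvexlyIndependent G S = ∀ a → a ∈ S → ¬ InHull G (S - a) a

-- Double count the pairs (v, T) with v ∈ S a vertex of the triangle T.  A vertex
-- of S on no triangle is counted by m; every other vertex of S lies in at least
-- one pair.  Each triangle lies in at most two pairs: were all three of its
-- vertices in S, the third would be in the Δ-interval of the other two,
-- contradicting independence.
module Submission where

open import Defs
open import Data.Nat using (ℕ; _+_; _*_; _≤_)
open import Data.Fin.Subset using (Subset; ∣_∣)

open import Data.Bool using (Bool; T; true; false; not)
open import Data.Bool.Properties using (T-∧; T-∨; T-≡)
open import Data.Empty using (⊥; ⊥-elim)
open import Data.Fin as Fin using (Fin; toℕ)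
open import Data.Fin.Properties using (<-cmp; <⇒≢)
open import Data.Fin.Subset using (_∈_; _∉_)
open import Data.Fin.Subset.Properties using (x∈p∧x≢y⇒x∈p-y)
open import Data.List using (map; tabulate; allFin)
import Data.Nat.ListAction as List
open import Data.Nat using (zero; suc; _<_; z≤n; s≤s)
open import Data.Nat.Properties
  using (+-*-semiring; ≤-refl; ≤-trans; ≤-reflexive; +-mono-≤; m≤m+n; m≤n+m;
         *-distribˡ-+; *-distribʳ-+; *-zeroʳ; +-identityʳ; <-trans; <⇒<ᵇ; <ᵇ⇒<;
         module ≤-Reasoning)
open import Data.Product using (∃; ∃₂; _×_; _,_)
open import Data.Sum using (inj₁; inj₂)
open import Data.Vec using (lookup; []; _∷_)
open import Data.Vec.Properties using (lookup⇒[]=)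
open import Function using (_∘_; id)
open import Function.Bundles using (module Equivalence)
open import Relation.Binary.Definitions using (tri<; tri≈; tri>)
open import Relation.Binary.PropositionalEquality as ≡ using (_≡_; _≢_; refl; cong)
open import Algebra.Properties.Semiring.Sum +-*-semiring
  using (sum-syntax; sum-cong-≗; ∑-distrib-+; ∑-comm; *-distribˡ-sum)

open Equivalence using (to; from)

sum-map-tabulate : ∀ {A : Set} {n} (g : Fin n → A) (f : A → ℕ) →
  List.sum (map f (tabulate g)) ≡ ∑[ i < n ] f (g i)
sum-map-tabulate {n = zero}  g f = refl
sum-map-tabulate {n = suc n} g f = cong (f (g Fin.zero) +_) (sum-map-tabulate (g ∘ Fin.suc) f)

sum-map-allFin : ∀ {n} (f : Fin n → ℕ) → List.sum (map f (allFin n)) ≡ ∑[ i < n ] f i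
sum-map-allFin = sum-map-tabulate id

∑-mono-≤ : ∀ {n} {f g : Fin n → ℕ} → (∀ i → f i ≤ g i) → ∑[ i < n ] f i ≤ ∑[ i < n ] g i
∑-mono-≤ {zero}  f≤g = z≤n
∑-mono-≤ {suc n} f≤g = +-mono-≤ (f≤g Fin.zero) (∑-mono-≤ (f≤g ∘ Fin.suc))

≤-∑ : ∀ {n} (f : Fin n → ℕ) i → f i ≤ ∑[ j < n ] f j
≤-∑ f Fin.zero    = m≤m+n _ _
≤-∑ f (Fin.suc i) = ≤-trans (≤-∑ (f ∘ Fin.suc) i) (m≤n+m _ _)

∑³ : ∀ {n} → (Fin n → Fin n → Fin n → ℕ) → ℕ
∑³ {n} f = ∑[ i < n ] ∑[ j < n ] ∑[ l < n ] f i j l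

∑³-mono-≤ : ∀ {n} {f g : Fin n → Fin n → Fin n → ℕ} →
  (∀ i j l → f i j l ≤ g i j l) → ∑³ f ≤ ∑³ g
∑³-mono-≤ f≤g = ∑-mono-≤ λ i → ∑-mono-≤ λ j → ∑-mono-≤ (f≤g i j)

∑³-distrib-+ : ∀ {n} (f g : Fin n → Fin n → Fin n → ℕ) →
  ∑³ (λ i j l → f i j l + g i j l) ≡ ∑³ f + ∑³ g
∑³-distrib-+ {n} f g = ≡.trans
  (sum-cong-≗ λ i → ≡.trans (sum-cong-≗ λ j → ∑-distrib-+ (f i j) (g i j))
                             (∑-distrib-+ (λ j → ∑[ l < n ] f i j l) (λ j → ∑[ l < n ] g i j l)))
  (∑-distrib-+ (λ i → ∑[ j < n ] ∑[ l < n ] f i j l) (λ i → ∑[ j < n ] ∑[ l < n ] g i j l))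

∑³-distrib-+³ : ∀ {n} (f g h : Fin n → Fin n → Fin n → ℕ) →
  ∑³ (λ i j l → f i j l + g i j l + h i j l) ≡ ∑³ f + ∑³ g + ∑³ h
∑³-distrib-+³ f g h = ≡.trans (∑³-distrib-+ (λ i j l → f i j l + g i j l) h)
                              (cong (_+ ∑³ h) (∑³-distrib-+ f g))

*-distribˡ-+³ : ∀ t a b c → t * (a + b + c) ≡ t * a + t * b + t * c
*-distribˡ-+³ t a b c = ≡.trans (*-distribˡ-+ t (a + b) c) (cong (_+ t * c) (*-distribˡ-+ t a b))

*-distribʳ-+³ : ∀ t a b c → (a + b + c) * t ≡ a * t + b * t + c * t
*-distribʳ-+³ t a b c = ≡.trans (*-distribʳ-+ t (a + b) c) (cong (_+ c * t) (*-distribʳ-+ t a b))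

*-distribˡ-∑² : ∀ {n} c (f : Fin n → Fin n → ℕ) →
  c * (∑[ i < n ] ∑[ j < n ] f i j) ≡ ∑[ i < n ] ∑[ j < n ] (c * f i j)
*-distribˡ-∑² {n} c f = ≡.trans (*-distribˡ-sum c (λ i → ∑[ j < n ] f i j))
                                (sum-cong-≗ λ i → *-distribˡ-sum c (f i))

*-distribˡ-∑³ : ∀ {n} c (f : Fin n → Fin n → Fin n → ℕ) → c * ∑³ f ≡ ∑³ (λ i j l → c * f i j l)
*-distribˡ-∑³ {n} c f = ≡.trans (*-distribˡ-sum c (λ i → ∑[ j < n ] ∑[ l < n ] f i j l))
                                (sum-cong-≗ λ i → *-distribˡ-∑² c (f i))

T⇒1≤indicator : ∀ {b} → T b → 1 ≤ indicator b
T⇒1≤indicator {true} _ = ≤-refl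

indicator-sum≤2 : ∀ a b c t → (T t → T a → T b → T c → ⊥) →
  (indicator a + indicator b + indicator c) * indicator t ≤ 2 * indicator t
indicator-sum≤2 a     b     c     false _      =
  ≤-reflexive (*-zeroʳ (indicator a + indicator b + indicator c))
indicator-sum≤2 true  true  true  true  notAll = ⊥-elim (notAll _ _ _ _)
indicator-sum≤2 true  true  false true  _      = ≤-refl
indicator-sum≤2 true  false true  true  _      = ≤-refl
indicator-sum≤2 false true  true  true  _      = ≤-refl
indicator-sum≤2 true  false false true  _      = s≤s z≤n
indicator-sum≤2 false true  false true  _      = s≤s z≤n
indicator-sum≤2 false false true  true  _      = s≤s z≤n
indicator-sum≤2 false false false true  _      = z≤n

T-lookup⇒∈ : ∀ {n} {p : Subset n} {i} → T (lookup p i) → i ∈ p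
T-lookup⇒∈ {p = p} {i} pᵢ = lookup⇒[]= i p (to T-≡ pᵢ)

∣p∣≡∑indicator : ∀ {n} (p : Subset n) → ∣ p ∣ ≡ ∑[ i < n ] indicator (lookup p i)
∣p∣≡∑indicator []          = refl
∣p∣≡∑indicator (true ∷ p)  = cong suc (∣p∣≡∑indicator p)
∣p∣≡∑indicator (false ∷ p) = ∣p∣≡∑indicator p

anyFin-elim : ∀ {n} (f : Fin n → Bool) → T (anyFin f) → ∃ λ i → T (f i)
anyFin-elim {zero}  f ()
anyFin-elim {suc n} f p with to T-∨ p
... | inj₁ f₀ = Fin.zero , f₀
... | inj₂ q  with anyFin-elim (f ∘ Fin.suc) q
...   | i , fᵢ = Fin.suc i , fᵢ

module _ {n : ℕ} (G : Graph n) where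

  Adjacent : Fin n → Fin n → Set
  Adjacent x y = T (adj G x y)

  adjacent-sym : ∀ {x y} → Adjacent x y → Adjacent y x
  adjacent-sym {x} {y} = ≡.subst T (sym G x y)

  adjacent⇒≢ : ∀ {x y} → Adjacent x y → x ≢ y
  adjacent⇒≢ {x} xy refl = ≡.subst T (irrefl G x) xy

  onTriangle-elim : ∀ {v} → T (onTriangle G v) →
    ∃₂ λ u w → Adjacent v u × Adjacent v w × Adjacent u w
  onTriangle-elim p with anyFin-elim _ p
  ... | u , q with anyFin-elim _ q
  ...   | w , r with to T-∧ r
  ...     | vu , s with to T-∧ s
  ...       | vw , uw = u , w , vu , vw , uw

  isTriangle-intro : ∀ {a b c} → toℕ a < toℕ b → toℕ b < toℕ c →
    Adjacent a b → Adjacent b c → Adjacent a c → T (isTriangle G a b c)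
  isTriangle-intro a<b b<c ab bc ac =
    from T-∧ (<⇒<ᵇ a<b , from T-∧ (<⇒<ᵇ b<c , from T-∧ (ab , from T-∧ (bc , ac))))

  isTriangle-elim : ∀ {a b c} → T (isTriangle G a b c) →
    toℕ a < toℕ b × toℕ b < toℕ c × Adjacent a b × Adjacent b c × Adjacent a c
  isTriangle-elim {a} {b} {c} p with to T-∧ p
  ... | a<ᵇb , q with to T-∧ q
  ...   | b<ᵇc , r with to T-∧ r
  ...     | ab , s with to T-∧ s
  ...       | bc , ac = <ᵇ⇒< (toℕ a) (toℕ b) a<ᵇb , <ᵇ⇒< (toℕ b) (toℕ c) b<ᵇc , ab , bc , ac

  △ : Fin n → Fin n → Fin n → ℕ
  △ i j l = indicator (isTriangle G i j l)

  -- Each triangle through v is counted once: as △ v a b, △ a v b or △ a b v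
  -- according to the position of v in its increasing enumeration.
  incidences : Fin n → Fin n → Fin n → ℕ
  incidences v a b = △ v a b + △ a v b + △ a b v

  triangleDegree : Fin n → ℕ
  triangleDegree v = ∑[ a < n ] ∑[ b < n ] incidences v a b

  incidences-ordered : ∀ {v u w} → toℕ u < toℕ w →
    Adjacent v u → Adjacent v w → Adjacent u w → 1 ≤ incidences v u w
  incidences-ordered {v} {u} {w} u<w vu vw uw with <-cmp v u
  ... | tri< v<u _ _ = ≤-trans (T⇒1≤indicator (isTriangle-intro v<u u<w vu uw vw))
                               (≤-trans (m≤m+n (△ v u w) (△ u v w)) (m≤m+n _ (△ u w v)))
  ... | tri≈ _ v≡u _ = ⊥-elim (adjacent⇒≢ vu v≡u)
  ... | tri> _ _ u<v with <-cmp v w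
  ...   | tri< v<w _ _ = ≤-trans (T⇒1≤indicator (isTriangle-intro u<v v<w (adjacent-sym vu) vw uw))
                                 (≤-trans (m≤n+m (△ u v w) (△ v u w)) (m≤m+n _ (△ u w v)))
  ...   | tri≈ _ v≡w _ = ⊥-elim (adjacent⇒≢ vw v≡w)
  ...   | tri> _ _ w<v = ≤-trans (T⇒1≤indicator
                                   (isTriangle-intro u<w w<v uw (adjacent-sym vw) (adjacent-sym vu)))
                                 (m≤n+m (△ u w v) (△ v u w + △ u v w))

  incidences≤triangleDegree : ∀ v a b → incidences v a b ≤ triangleDegree v
  incidences≤triangleDegree v a b =
    ≤-trans (≤-∑ (incidences v a) b) (≤-∑ (λ a → ∑[ b < n ] incidences v a b) a)

  onTriangle⇒1≤triangleDegree : ∀ {v} → T (onTriangle G v) → 1 ≤ triangleDegree v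
  onTriangle⇒1≤triangleDegree {v} p with onTriangle-elim p
  ... | u , w , vu , vw , uw with <-cmp u w
  ...   | tri< u<w _ _ = ≤-trans (incidences-ordered u<w vu vw uw)
                                 (incidences≤triangleDegree v u w)
  ...   | tri≈ _ u≡w _ = ⊥-elim (adjacent⇒≢ uw u≡w)
  ...   | tri> _ _ w<u = ≤-trans (incidences-ordered w<u vw vu (adjacent-sym uw))
                                 (incidences≤triangleDegree v w u)

  triangleCount≡∑³△ : triangleCount G ≡ ∑³ △
  triangleCount≡∑³△ = ≡.trans (sum-map-allFin (λ i → ∑ᴸ (λ j → ∑ᴸ (△ i j))))
    (sum-cong-≗ λ i → ≡.trans (sum-map-allFin (λ j → ∑ᴸ (△ i j)))
                               (sum-cong-≗ λ j → sum-map-allFin (△ i j)))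
    where
    ∑ᴸ : (Fin n → ℕ) → ℕ
    ∑ᴸ f = List.sum (map f (allFin n))

  offTriangle : Fin n → ℕ
  offTriangle v = indicator (not (onTriangle G v))

  module _ (S : Subset n) where

    χ : Fin n → ℕ
    χ v = indicator (lookup S v)

    χ≤offTriangle+χ*triangleDegree : ∀ v →
      χ v ≤ offTriangle v + χ v * triangleDegree v
    χ≤offTriangle+χ*triangleDegree v with lookup S v | onTriangle G v in onTri
    ... | false | _     = z≤n
    ... | true  | false = s≤s z≤n
    ... | true  | true  = ≤-trans (onTriangle⇒1≤triangleDegree (≡.subst T (≡.sym onTri) _))
                                  (≤-reflexive (≡.sym (+-identityʳ (triangleDegree v))))

    ∑χ*triangleDegree≡∑³ : ∑[ v < n ] (χ v * triangleDegree v) ≡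
      ∑³ (λ i j l → (χ i + χ j + χ l) * △ i j l)
    ∑χ*triangleDegree≡∑³ = begin
      ∑[ v < n ] (χ v * triangleDegree v)
        ≡⟨ sum-cong-≗ (λ v → ≡.trans (*-distribˡ-∑² (χ v) (incidences v))
             (sum-cong-≗ λ a → sum-cong-≗ λ b → *-distribˡ-+³ (χ v) (△ v a b) (△ a v b) (△ a b v))) ⟩
      ∑³ (λ v a b → χ v * △ v a b + χ v * △ a v b + χ v * △ a b v)
        ≡⟨ ∑³-distrib-+³ (λ v a b → χ v * △ v a b) (λ v a b → χ v * △ a v b)
                         (λ v a b → χ v * △ a b v) ⟩
      ∑³ (λ v a b → χ v * △ v a b) + ∑³ (λ v a b → χ v * △ a v b) + ∑³ (λ v a b → χ v * △ a b v)
        ≡⟨ ≡.cong₂ _+_ (≡.cong (∑³ (λ i j l → χ i * △ i j l) +_) middle) last ⟩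
      ∑³ (λ i j l → χ i * △ i j l) + ∑³ (λ i j l → χ j * △ i j l) + ∑³ (λ i j l → χ l * △ i j l)
        ≡⟨ ≡.sym (∑³-distrib-+³ (λ i j l → χ i * △ i j l) (λ i j l → χ j * △ i j l)
                                (λ i j l → χ l * △ i j l)) ⟩
      ∑³ (λ i j l → χ i * △ i j l + χ j * △ i j l + χ l * △ i j l)
        ≡⟨ ≡.sym (sum-cong-≗ λ i → sum-cong-≗ λ j → sum-cong-≗ λ l →
                    *-distribʳ-+³ (△ i j l) (χ i) (χ j) (χ l)) ⟩
      ∑³ (λ i j l → (χ i + χ j + χ l) * △ i j l)
        ∎
      where
      open ≡.≡-Reasoning
      middle : ∑³ (λ v a b → χ v * △ a v b) ≡ ∑³ (λ i j l → χ j * △ i j l)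
      middle = ∑-comm (λ v a → ∑[ b < n ] (χ v * △ a v b))
      last : ∑³ (λ v a b → χ v * △ a b v) ≡ ∑³ (λ i j l → χ l * △ i j l)
      last = ≡.trans (∑-comm (λ v a → ∑[ b < n ] (χ v * △ a b v)))
                     (sum-cong-≗ λ a → ∑-comm (λ v b → χ v * △ a b v))

    triangle⊈independent : ConvexlyIndependent G S → ∀ {i j l} →
      T (isTriangle G i j l) → i ∈ S → j ∈ S → l ∉ S
    triangle⊈independent independent {i} {j} {l} ijl i∈S j∈S l∈S with isTriangle-elim ijl
    ... | i<j , j<l , ij , jl , il = independent l l∈S λ C S-l⊆C C-convex →
      C-convex l (inj₂ (i , j , S-l⊆C (x∈p∧x≢y⇒x∈p-y i∈S (<⇒≢ (<-trans i<j j<l))) ,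
                                S-l⊆C (x∈p∧x≢y⇒x∈p-y j∈S (<⇒≢ j<l)) ,
                                ij , adjacent-sym il , adjacent-sym jl))

    ∑χ*triangleDegree≤2*triangleCount : ConvexlyIndependent G S →
      ∑[ v < n ] (χ v * triangleDegree v) ≤ 2 * triangleCount G
    ∑χ*triangleDegree≤2*triangleCount independent = begin
      ∑[ v < n ] (χ v * triangleDegree v)          ≡⟨ ∑χ*triangleDegree≡∑³ ⟩
      ∑³ (λ i j l → (χ i + χ j + χ l) * △ i j l)  ≤⟨ ∑³-mono-≤ atMostTwo ⟩
      ∑³ (λ i j l → 2 * △ i j l)                  ≡⟨ ≡.sym (*-distribˡ-∑³ 2 △) ⟩
      2 * ∑³ △                                    ≡⟨ cong (2 *_) (≡.sym triangleCount≡∑³△) ⟩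
      2 * triangleCount G                         ∎
      where
      open ≤-Reasoning
      atMostTwo : ∀ i j l → (χ i + χ j + χ l) * △ i j l ≤ 2 * △ i j l
      atMostTwo i j l = indicator-sum≤2 (lookup S i) (lookup S j) (lookup S l) (isTriangle G i j l)
        λ ijl i∈S j∈S l∈S → triangle⊈independent independent ijl
                              (T-lookup⇒∈ i∈S) (T-lookup⇒∈ j∈S) (T-lookup⇒∈ l∈S)

theorem6 : (n : ℕ) (G : Graph n) → Connected G →
    (S : Subset n) → ConvexlyIndependent G S →
    ∣ S ∣ ≤ triangleFreeVertexCount G + 2 * triangleCount G
theorem6 n G _ S independent = begin
  ∣ S ∣                                          ≡⟨ ∣p∣≡∑indicator S ⟩
  ∑[ v < n ] χ G S v                             ≤⟨ ∑-mono-≤ (χ≤offTriangle+χ*triangleDegree G S) ⟩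
  ∑[ v < n ] (offTriangle G v + χ G S v * triangleDegree G v)
                                                 ≡⟨ ∑-distrib-+ (offTriangle G) (λ v → χ G S v * triangleDegree G v) ⟩
  ∑[ v < n ] offTriangle G v + ∑[ v < n ] (χ G S v * triangleDegree G v)
                                                 ≤⟨ +-mono-≤ (≤-reflexive (≡.sym (sum-map-allFin (offTriangle G))))
                                                             (∑χ*triangleDegree≤2*triangleCount G S independent) ⟩
  triangleFreeVertexCount G + 2 * triangleCount G  ∎
  where open ≤-Reasoning
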